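{- Let $p$ be an odd prime and $k\ge 1$ an integer. Then $p^k\in\mathfrak{P}$ if and only if $k$ is odd.
   Context: For an odd positive integer $n$, put $G(n)=\sum_{j=1}^{n-1} j^{(n-1)/2}$. Let $\mathfrak{P}$ denote the set of odd positive integers $n$ such that $G(n)\equiv 0\pmod n$. -}

module Defs where

open import Data.Nat using (ℕ; zero; suc; _+_; _∸_; _^_; _/_; _≤_)
open import Data.Nat.Divisibility using (_∣_)
open import Data.Nat.ListAction using (sum)
open import Data.List using (map)
open import Data.List.Base using (upTo)
open import Data.Product using (_×_)
open import Relation.Nullary using (¬_)

Odd : ℕ → Set
Odd n = ¬ (2 ∣ n)

-- G(n) = Σ_{j=1}^{n-1} j^((n-1)/2)  ; upTo (n ∸ 1) = [0 .. n-2], shifted by 1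
G : ℕ → ℕ
G n = sum (map (λ i → (suc i) ^ ((n ∸ 1) / 2)) (upTo (n ∸ 1)))

𝔓 : ℕ → Set
𝔓 n = Odd n × (1 ≤ n) × (n ∣ G n)

-- Write powerSum N e = ∑_{j<N} j ^ e; for n = p ^ k
-- one has n = 1 + 2h X and G n = powerSum n (h X).  The argument combines:
--  (1) lifting, for every odd m: powerSum (m ^ (k+1)) e ≡ m ^ k * powerSum m e
--      modulo m ^ (k+1), by cutting [0, m c) into m blocks of length c and
--      expanding (b + a c) ^ e to first order; so m ^ (k+1) divides
--      powerSum (m ^ (k+1)) e iff m divides powerSum m e;
--  (2) power sums modulo a prime p = q + 1: p ∣ powerSum p e for e < q (a
--      telescoping binomial identity), powerSum p e only depends on e mod q
--      for e ≥ 1 (Fermat), and powerSum p e ≡ q ≢ 0 for positive multiples e of q;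
--  (3) the shape of p ^ k: X is odd for odd k, so h X ≡ h (mod q) with h < q,
--      while X is even for even k, so q ∣ h X.
-- The file first develops finite sums, congruences, binomial coefficients and
-- first-order expansions, then (2), (1) with (3), and finally the theorem.
module Submission where

open import Defs
open import Data.Nat using (ℕ; _^_; _≤_)
open import Data.Nat.Primality using (Prime)
open import Function.Bundles using (_⇔_)

open import Data.Nat
open import Data.Nat.Properties
open import Data.Nat.Divisibility
open import Data.Nat.DivMod using (m*n/n≡m)
open import Data.Nat.Primality using (¬prime[1]; euclidsLemma)
open import Data.Nat.Combinatorics using (_C_; nCn≡1; nC1≡n; nCk≡nC[n∸k]; nCk+nC[k+1]≡[n+1]C[k+1]; k>n⇒nCk≡0)
open import Data.Nat.Induction using (<-rec)
open import Data.Nat.Tactic.RingSolver using (solve-∀)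
open import Data.Nat.ListAction using (sum)
open import Data.List.Base using (map; applyUpTo)
open import Data.Fin.Base using (Fin; toℕ)
open import Data.Product using (∃-syntax; _,_)
open import Data.Sum using (_⊎_; inj₁; inj₂)
open import Function.Base using (_∘_; id)
open import Function.Bundles using (mk⇔; Equivalence)
open import Level using (0ℓ)
open import Relation.Nullary using (¬_; contradiction)
open import Relation.Binary.Bundles using (Setoid)
open import Relation.Binary.Structures using (IsEquivalence)
open import Relation.Binary.PropositionalEquality
import Relation.Binary.Reasoning.Setoid as SetoidReasoning
import Algebra.Properties.CommutativeSemiring.Binomial +-*-commutativeSemiring as Binomial
open import Algebra.Properties.Semiring.Exp +-*-semiring using () renaming (_^_ to _^ₛ_)
open import Algebra.Definitions.RawMonoid +-0-rawMonoid using () renaming (_×_ to _×ₙ_)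
import Algebra.Properties.Monoid.Sum +-0-monoid as FinSum

∑ : ℕ → (ℕ → ℕ) → ℕ
∑ zero    f = 0
∑ (suc n) f = f 0 + ∑ n (f ∘ suc)

∑-cong : ∀ n {f g : ℕ → ℕ} → (∀ j → j < n → f j ≡ g j) → ∑ n f ≡ ∑ n g
∑-cong zero    f≡g = refl
∑-cong (suc n) f≡g = cong₂ _+_ (f≡g 0 z<s) (∑-cong n (λ j j<n → f≡g (suc j) (s<s j<n)))

∑-+ : ∀ n (f g : ℕ → ℕ) → ∑ n (λ j → f j + g j) ≡ ∑ n f + ∑ n g
∑-+ zero    f g = refl
∑-+ (suc n) f g = begin
  f 0 + g 0 + ∑ n (λ j → f (suc j) + g (suc j)) ≡⟨ cong (f 0 + g 0 +_) (∑-+ n (f ∘ suc) (g ∘ suc)) ⟩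
  f 0 + g 0 + (∑ n (f ∘ suc) + ∑ n (g ∘ suc))   ≡⟨ +-shuffle (f 0) (g 0) _ _ ⟩
  f 0 + ∑ n (f ∘ suc) + (g 0 + ∑ n (g ∘ suc))   ∎
  where
  open ≡-Reasoning
  +-shuffle : ∀ a b c d → a + b + (c + d) ≡ a + c + (b + d)
  +-shuffle = solve-∀

∑-*ˡ : ∀ n c (f : ℕ → ℕ) → ∑ n (λ j → c * f j) ≡ c * ∑ n f
∑-*ˡ zero    c f = sym (*-zeroʳ c)
∑-*ˡ (suc n) c f = trans (cong (c * f 0 +_) (∑-*ˡ n c (f ∘ suc))) (sym (*-distribˡ-+ c (f 0) _))

∑-*ʳ : ∀ n c (f : ℕ → ℕ) → ∑ n (λ j → f j * c) ≡ ∑ n f * c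
∑-*ʳ n c f = trans (∑-cong n (λ j _ → *-comm (f j) c)) (trans (∑-*ˡ n c f) (*-comm c (∑ n f)))

∑-const : ∀ n c → ∑ n (λ _ → c) ≡ n * c
∑-const zero    c = refl
∑-const (suc n) c = cong (c +_) (∑-const n c)

∑-last : ∀ n (f : ℕ → ℕ) → ∑ (suc n) f ≡ ∑ n f + f n
∑-last zero    f = +-comm (f 0) 0
∑-last (suc n) f = trans (cong (f 0 +_) (∑-last n (f ∘ suc))) (sym (+-assoc (f 0) _ _))

∑-split : ∀ a b (f : ℕ → ℕ) → ∑ (a + b) f ≡ ∑ a f + ∑ b (λ j → f (a + j))
∑-split zero    b f = refl
∑-split (suc a) b f = trans (cong (f 0 +_) (∑-split a b (f ∘ suc))) (sym (+-assoc (f 0) _ _))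

∑-blocks : ∀ m c (f : ℕ → ℕ) → ∑ (m * c) f ≡ ∑ m (λ a → ∑ c (λ b → f (a * c + b)))
∑-blocks zero    c f = refl
∑-blocks (suc m) c f = begin
  ∑ (c + m * c) f                                        ≡⟨ ∑-split c (m * c) f ⟩
  ∑ c f + ∑ (m * c) (λ j → f (c + j))                    ≡⟨ cong (∑ c f +_) (∑-blocks m c (λ j → f (c + j))) ⟩
  ∑ c f + ∑ m (λ a → ∑ c (λ b → f (c + (a * c + b))))    ≡⟨ cong (∑ c f +_) (∑-cong m λ a _ → ∑-cong c λ b _ →
                                                              cong f (sym (+-assoc c (a * c) b))) ⟩
  ∑ c f + ∑ m (λ a → ∑ c (λ b → f (suc a * c + b)))      ∎
  where open ≡-Reasoning

∑-swap : ∀ n m (f : ℕ → ℕ → ℕ) → ∑ n (λ i → ∑ m (f i)) ≡ ∑ m (λ j → ∑ n (λ i → f i j))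
∑-swap zero    m f = sym (trans (∑-const m 0) (*-zeroʳ m))
∑-swap (suc n) m f = trans (cong (∑ m (f 0) +_) (∑-swap n m (f ∘ suc))) (sym (∑-+ m (f 0) _))

∑-∣ : ∀ n {d} (f : ℕ → ℕ) → (∀ j → j < n → d ∣ f j) → d ∣ ∑ n f
∑-∣ zero    f d∣f = _ ∣0
∑-∣ (suc n) f d∣f = ∣m∣n⇒∣m+n (d∣f 0 z<s) (∑-∣ n (f ∘ suc) (λ j j<n → d∣f (suc j) (s<s j<n)))

∑-id-odd : ∀ h → ∑ (suc (2 * h)) id ≡ suc (2 * h) * h
∑-id-odd zero    = refl
∑-id-odd (suc h) = begin
  ∑ (suc (2 * suc h)) id                 ≡⟨ cong (λ n → ∑ (suc n) id) (*-suc 2 h) ⟩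
  ∑ (suc (suc (suc (2 * h)))) id         ≡⟨ ∑-last (suc (suc (2 * h))) id ⟩
  ∑ (suc (suc (2 * h))) id + suc (suc (2 * h))
    ≡⟨ cong (_+ suc (suc (2 * h))) (∑-last (suc (2 * h)) id) ⟩
  ∑ (suc (2 * h)) id + suc (2 * h) + suc (suc (2 * h))
    ≡⟨ cong (λ s → s + suc (2 * h) + suc (suc (2 * h))) (∑-id-odd h) ⟩
  suc (2 * h) * h + suc (2 * h) + suc (suc (2 * h)) ≡⟨ gauss-step h ⟩
  suc (2 * suc h) * suc h                ∎
  where
  open ≡-Reasoning
  gauss-step : ∀ h → suc (2 * h) * h + suc (2 * h) + suc (suc (2 * h)) ≡ suc (2 * suc h) * suc h
  gauss-step = solve-∀

sum-map-applyUpTo : ∀ n (f g : ℕ → ℕ) → sum (map f (applyUpTo g n)) ≡ ∑ n (f ∘ g)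
sum-map-applyUpTo zero    f g = refl
sum-map-applyUpTo (suc n) f g = cong (f (g 0) +_) (sum-map-applyUpTo n f (g ∘ suc))

-- a ≡ b mod m : a and b become equal after adding suitable multiples of m.
-- Stated without subtraction, so it needs no side conditions on m.
infix 4 _≡_mod_
data _≡_mod_ (a b m : ℕ) : Set where
  by-multiples : ∀ x y → a + m * x ≡ b + m * y → a ≡ b mod m

module _ {m : ℕ} where

  mod-reflexive : ∀ {a b} → a ≡ b → a ≡ b mod m
  mod-reflexive refl = by-multiples 0 0 refl

  mod-refl : ∀ {a} → a ≡ a mod m
  mod-refl = mod-reflexive refl

  mod-sym : ∀ {a b} → a ≡ b mod m → b ≡ a mod m
  mod-sym (by-multiples x y eq) = by-multiples y x (sym eq)

  mod-trans : ∀ {a b c} → a ≡ b mod m → b ≡ c mod m → a ≡ c mod m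
  mod-trans {a} {b} {c} (by-multiples x y eq₁) (by-multiples x′ y′ eq₂) =
    by-multiples (x + x′) (y′ + y) (begin
      a + m * (x + x′)     ≡⟨ shift a x x′ ⟩
      (a + m * x) + m * x′ ≡⟨ cong (_+ m * x′) eq₁ ⟩
      (b + m * y) + m * x′ ≡⟨ swap b y x′ ⟩
      (b + m * x′) + m * y ≡⟨ cong (_+ m * y) eq₂ ⟩
      (c + m * y′) + m * y ≡⟨ sym (shift c y′ y) ⟩
      c + m * (y′ + y)     ∎)
    where
    open ≡-Reasoning
    shift : ∀ a x x′ → a + m * (x + x′) ≡ (a + m * x) + m * x′
    shift a x x′ = trans (cong (a +_) (*-distribˡ-+ m x x′)) (sym (+-assoc a _ _))
    swap : ∀ b y x′ → (b + m * y) + m * x′ ≡ (b + m * x′) + m * y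
    swap b y x′ = trans (+-assoc b _ _) (trans (cong (b +_) (+-comm (m * y) _)) (sym (+-assoc b _ _)))

  mod-isEquivalence : IsEquivalence (λ a b → a ≡ b mod m)
  mod-isEquivalence = record { refl = mod-refl ; sym = mod-sym ; trans = mod-trans }

  mod-multiple : ∀ a t → a + m * t ≡ a mod m
  mod-multiple a t = by-multiples 0 t (trans (cong (a + m * t +_) (*-zeroʳ m)) (+-identityʳ _))

  mod-+ : ∀ {a b c d} → a ≡ b mod m → c ≡ d mod m → a + c ≡ b + d mod m
  mod-+ {a} {b} {c} {d} (by-multiples x y eq₁) (by-multiples x′ y′ eq₂) =
    by-multiples (x + x′) (y + y′) (begin
      a + c + m * (x + x′)         ≡⟨ interleave a c x x′ ⟩
      (a + m * x) + (c + m * x′)   ≡⟨ cong₂ _+_ eq₁ eq₂ ⟩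
      (b + m * y) + (d + m * y′)   ≡⟨ sym (interleave b d y y′) ⟩
      b + d + m * (y + y′)         ∎)
    where
    open ≡-Reasoning
    interleave : ∀ a c x x′ → a + c + m * (x + x′) ≡ (a + m * x) + (c + m * x′)
    interleave a c x x′ = identity a c x x′ m
      where
      identity : ∀ a c x x′ m → a + c + m * (x + x′) ≡ (a + m * x) + (c + m * x′)
      identity = solve-∀

  mod-*ˡ : ∀ c {a b} → a ≡ b mod m → c * a ≡ c * b mod m
  mod-*ˡ c {a} {b} (by-multiples x y eq) = by-multiples (c * x) (c * y) (begin
    c * a + m * (c * x) ≡⟨ pull c a x m ⟩
    c * (a + m * x)     ≡⟨ cong (c *_) eq ⟩
    c * (b + m * y)     ≡⟨ sym (pull c b y m) ⟩
    c * b + m * (c * y) ∎)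
    where
    open ≡-Reasoning
    pull : ∀ c a x m → c * a + m * (c * x) ≡ c * (a + m * x)
    pull = solve-∀

  mod-* : ∀ {a b c d} → a ≡ b mod m → c ≡ d mod m → a * c ≡ b * d mod m
  mod-* {a} {b} {c} {d} a≡b c≡d = mod-trans (mod-*ˡ a c≡d)
    (mod-trans (mod-reflexive (*-comm a d)) (mod-trans (mod-*ˡ d a≡b) (mod-reflexive (*-comm d b))))

  mod-^ : ∀ {a b} → a ≡ b mod m → ∀ e → a ^ e ≡ b ^ e mod m
  mod-^ a≡b zero    = mod-refl
  mod-^ a≡b (suc e) = mod-* a≡b (mod-^ a≡b e)

  mod-∑ : ∀ n {f g : ℕ → ℕ} → (∀ j → j < n → f j ≡ g j mod m) → ∑ n f ≡ ∑ n g mod m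
  mod-∑ zero    f≡g = mod-refl
  mod-∑ (suc n) f≡g = mod-+ (f≡g 0 z<s) (mod-∑ n (λ j j<n → f≡g (suc j) (s<s j<n)))

  ∣⇒≡0 : ∀ {a} → m ∣ a → a ≡ 0 mod m
  ∣⇒≡0 (divides t refl) = by-multiples 0 t (trans (cong (t * m +_) (*-zeroʳ m)) (trans (+-identityʳ _) (*-comm t m)))

  mod-∣ : ∀ {a b} → a ≡ b mod m → m ∣ a → m ∣ b
  mod-∣ {a} {b} (by-multiples x y eq) m∣a =
    ∣m+n∣m⇒∣n (subst (m ∣_) (trans eq (+-comm b (m * y))) (∣m∣n⇒∣m+n m∣a (m∣m*n x))) (m∣m*n y)

mod-setoid : ℕ → Setoid 0ℓ 0ℓ
mod-setoid m = record { Carrier = ℕ ; _≈_ = λ a b → a ≡ b mod m ; isEquivalence = mod-isEquivalence }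

module ≡-mod-Reasoning (m : ℕ) = SetoidReasoning (mod-setoid m)

mod-divisor : ∀ {a b d m} → d ∣ m → a ≡ b mod m → a ≡ b mod d
mod-divisor {a} {b} {d} (divides t refl) (by-multiples x y eq) =
  by-multiples (t * x) (t * y) (trans (cong (a +_) (regroup t d x)) (trans eq (cong (b +_) (sym (regroup t d y)))))
  where
  regroup : ∀ t d x → d * (t * x) ≡ t * d * x
  regroup = solve-∀

mod-scale : ∀ k {a b m} → a ≡ b mod m → k * a ≡ k * b mod k * m
mod-scale k {a} {b} {m} (by-multiples x y eq) =
  by-multiples x y (trans (regroup k a m x) (trans (cong (k *_) eq) (sym (regroup k b m y))))
  where
  regroup : ∀ k a m x → k * a + k * m * x ≡ k * (a + m * x)
  regroup = solve-∀

-- Cancelling a factor prime to a prime modulus p, first when the smaller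
-- side is on the left: j a ≡ j (a + d) forces p ∣ j d, hence p ∣ d.
cancel-≤ : ∀ {p j a b} → Prime p → ¬ p ∣ j → a ≤ b → j * a ≡ j * b mod p → a ≡ b mod p
cancel-≤ {p} {j} {a} {b} p-prime p∤j a≤b (by-multiples x y eq) with euclidsLemma j d p-prime p∣j*d
  where
  d = b ∸ a
  b≡a+d : b ≡ a + d
  b≡a+d = sym (m+[n∸m]≡n a≤b)
  px≡jd+py : p * x ≡ j * d + p * y
  px≡jd+py = +-cancelˡ-≡ (j * a) _ _ (begin
    j * a + p * x           ≡⟨ eq ⟩
    j * b + p * y           ≡⟨ cong (λ n → j * n + p * y) b≡a+d ⟩
    j * (a + d) + p * y     ≡⟨ expand j a d (p * y) ⟩
    j * a + (j * d + p * y) ∎)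
    where
    open ≡-Reasoning
    expand : ∀ j a d z → j * (a + d) + z ≡ j * a + (j * d + z)
    expand = solve-∀
  p∣j*d : p ∣ j * d
  p∣j*d = ∣m+n∣m⇒∣n (subst (p ∣_) (trans px≡jd+py (+-comm (j * d) (p * y))) (m∣m*n x)) (m∣m*n y)
... | inj₁ p∣j = contradiction p∣j p∤j
... | inj₂ (divides t d≡tp) = by-multiples t 0 (begin
  a + p * t ≡⟨ cong (a +_) (*-comm p t) ⟩
  a + t * p ≡⟨ cong (a +_) d≡tp ⟨
  a + (b ∸ a) ≡⟨ m+[n∸m]≡n a≤b ⟩
  b ≡⟨ +-identityʳ b ⟨
  b + 0 ≡⟨ cong (b +_) (*-zeroʳ p) ⟨
  b + p * 0 ∎)
  where open ≡-Reasoning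

mod-cancel : ∀ {p j a b} → Prime p → ¬ p ∣ j → j * a ≡ j * b mod p → a ≡ b mod p
mod-cancel {a = a} {b} p-prime p∤j ja≡jb with ≤-total a b
... | inj₁ a≤b = cancel-≤ p-prime p∤j a≤b ja≡jb
... | inj₂ b≤a = mod-sym (cancel-≤ p-prime p∤j b≤a (mod-sym ja≡jb))

binomial : ∀ n a → suc a ^ n ≡ ∑ (suc n) (λ l → (n C l) * a ^ l)
binomial n a = begin
  suc a ^ n                                       ≡⟨ cong (_^ n) (+-comm 1 a) ⟩
  (a + 1) ^ n                                     ≡⟨ ^ₛ≡^ (a + 1) n ⟨
  (a + 1) ^ₛ n                                    ≡⟨ Binomial.theorem n a 1 ⟩
  Binomial.binomialExpansion a 1 n                ≡⟨ FinSum.sum-cong-≗ term≡ ⟩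
  FinSum.sum (λ (k : Fin (suc n)) → (n C toℕ k) * a ^ toℕ k) ≡⟨ FinSum≡∑ (suc n) (λ l → (n C l) * a ^ l) ⟩
  ∑ (suc n) (λ l → (n C l) * a ^ l)               ∎
  where
  open ≡-Reasoning
  ^ₛ≡^ : ∀ a n → a ^ₛ n ≡ a ^ n
  ^ₛ≡^ a zero    = refl
  ^ₛ≡^ a (suc n) = cong (a *_) (^ₛ≡^ a n)
  ×ₙ≡* : ∀ n a → n ×ₙ a ≡ n * a
  ×ₙ≡* zero    a = refl
  ×ₙ≡* (suc n) a = cong (a +_) (×ₙ≡* n a)
  FinSum≡∑ : ∀ n (f : ℕ → ℕ) → FinSum.sum (λ (k : Fin n) → f (toℕ k)) ≡ ∑ n f
  FinSum≡∑ zero    f = refl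
  FinSum≡∑ (suc n) f = cong (f 0 +_) (FinSum≡∑ n (f ∘ suc))
  term≡ : ∀ (k : Fin (suc n)) → (n C toℕ k) ×ₙ (a ^ₛ toℕ k * 1 ^ₛ (n ∸ toℕ k)) ≡ (n C toℕ k) * a ^ toℕ k
  term≡ k rewrite ×ₙ≡* (n C toℕ k) (a ^ₛ toℕ k * 1 ^ₛ (n ∸ toℕ k)) | ^ₛ≡^ a (toℕ k)
                | ^ₛ≡^ 1 (n ∸ toℕ k) | ^-zeroˡ (n ∸ toℕ k) | *-identityʳ (a ^ toℕ k) = refl

-- Absorption: (k + 1) * C(n + 1, k + 1) = (n + 1) * C(n, k), by induction on n
-- with Pascal's rule; the auxiliary identity collect uses the hypothesis at k - 1.
C-absorb : ∀ n k → suc k * (suc n C suc k) ≡ suc n * (n C k)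
C-absorb zero    zero    = refl
C-absorb zero    (suc k) = trans (cong (suc (suc k) *_) (k>n⇒nCk≡0 {1} {suc (suc k)} (s<s z<s)))
  (trans (*-zeroʳ (suc (suc k))) (cong (1 *_) (sym (k>n⇒nCk≡0 {0} {suc k} z<s))))
C-absorb (suc n) k = begin
  suc k * (suc (suc n) C suc k)                        ≡⟨ cong (suc k *_) (nCk+nC[k+1]≡[n+1]C[k+1] (suc n) k) ⟨
  suc k * ((suc n C k) + (suc n C suc k))              ≡⟨ *-distribˡ-+ (suc k) (suc n C k) (suc n C suc k) ⟩
  suc k * (suc n C k) + suc k * (suc n C suc k)        ≡⟨ cong (suc k * (suc n C k) +_) (C-absorb n k) ⟩
  suc k * (suc n C k) + suc n * (n C k)                ≡⟨ collect k ⟩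
  suc (suc n) * (suc n C k)                            ∎
  where
  open ≡-Reasoning
  collect : ∀ k → suc k * (suc n C k) + suc n * (n C k) ≡ suc (suc n) * (suc n C k)
  collect zero     = sum-ones n
    where
    sum-ones : ∀ n → 1 * 1 + suc n * 1 ≡ suc (suc n) * 1
    sum-ones = solve-∀
  collect (suc k′) = begin
    suc (suc k′) * (suc n C suc k′) + suc n * B      ≡⟨ cong (_+ suc n * B) (*-distribʳ-+ (suc n C suc k′) 1 (suc k′)) ⟩
    (1 * (suc n C suc k′) + suc k′ * (suc n C suc k′)) + suc n * B
      ≡⟨ cong (λ c → 1 * (suc n C suc k′) + c + suc n * B) (C-absorb n k′) ⟩
    (1 * (suc n C suc k′) + suc n * A) + suc n * B   ≡⟨ cong (λ c → 1 * c + suc n * A + suc n * B) pascal ⟨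
    (1 * (A + B) + suc n * A) + suc n * B            ≡⟨ regroup (suc n) A B ⟩
    suc (suc n) * (A + B)                            ≡⟨ cong (suc (suc n) *_) pascal ⟩
    suc (suc n) * (suc n C suc k′)                   ∎
    where
    A = n C k′
    B = n C suc k′
    pascal : A + B ≡ suc n C suc k′
    pascal = nCk+nC[k+1]≡[n+1]C[k+1] n k′
    regroup : ∀ m A B → 1 * (A + B) + m * A + m * B ≡ suc m * (A + B)
    regroup = solve-∀

prime∣C : ∀ {p l} → Prime p → 0 < l → l < p → p ∣ p C l
prime∣C {suc n} {suc k} p-prime _ l<p with euclidsLemma (suc k) (suc n C suc k) p-prime
                                              (subst (suc n ∣_) (sym (C-absorb n k)) (m∣m*n (n C k)))
... | inj₁ p∣l = contradiction p∣l (>⇒∤ l<p)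
... | inj₂ p∣C = p∣C

-- derivative e b = e * b ^ (e ∸ 1), the derivative of b ^ e with respect to b.
derivative : ℕ → ℕ → ℕ
derivative zero    b = 0
derivative (suc e) b = b * derivative e b + b ^ e

first-order : ∀ e b x → (b + x) ^ e ≡ b ^ e + x * derivative e b mod x * x
first-order zero    b x = mod-reflexive (sym (cong (1 +_) (*-zeroʳ x)))
first-order (suc e) b x = begin
  (b + x) * (b + x) ^ e                                      ≈⟨ mod-*ˡ (b + x) (first-order e b x) ⟩
  (b + x) * (b ^ e + x * derivative e b)                     ≡⟨ expand b x (b ^ e) (derivative e b) ⟩
  b * b ^ e + x * derivative (suc e) b + x * x * derivative e b ≈⟨ mod-multiple _ (derivative e b) ⟩
  b * b ^ e + x * derivative (suc e) b                       ∎
  where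
  open ≡-mod-Reasoning (x * x)
  expand : ∀ b x P d → (b + x) * (P + x * d) ≡ b * P + x * (b * d + P) + x * x * d
  expand = solve-∀

powerSum : ℕ → ℕ → ℕ
powerSum N e = ∑ N (λ j → j ^ e)

-- Summing the binomial expansions of (j + 1) ^ (i + 1) over j < N telescopes:
-- ∑_{l ≤ i} C(i + 1, l) * powerSum N l = N ^ (i + 1).
telescoping : ∀ N i → ∑ (suc i) (λ l → (suc i C l) * powerSum N l) ≡ N ^ suc i
telescoping N i = +-cancelˡ-≡ (powerSum N (suc i)) _ _ (begin
  powerSum N (suc i) + ∑ (suc i) F                  ≡⟨ +-comm (powerSum N (suc i)) _ ⟩
  ∑ (suc i) F + powerSum N (suc i)                  ≡⟨ cong (∑ (suc i) F +_) (*-identityˡ (powerSum N (suc i))) ⟨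
  ∑ (suc i) F + 1 * powerSum N (suc i)              ≡⟨ cong (λ c → ∑ (suc i) F + c * powerSum N (suc i)) (nCn≡1 (suc i)) ⟨
  ∑ (suc i) F + F (suc i)                           ≡⟨ ∑-last (suc i) F ⟨
  ∑ (suc (suc i)) F                                 ≡⟨ ∑-cong (suc (suc i)) (λ l _ → ∑-*ˡ N (suc i C l) (_^ l)) ⟨
  ∑ (suc (suc i)) (λ l → ∑ N (λ j → (suc i C l) * j ^ l)) ≡⟨ ∑-swap (suc (suc i)) N (λ l j → (suc i C l) * j ^ l) ⟩
  ∑ N (λ j → ∑ (suc (suc i)) (λ l → (suc i C l) * j ^ l)) ≡⟨ ∑-cong N (λ j _ → binomial (suc i) j) ⟨
  ∑ N (λ j → suc j ^ suc i)                         ≡⟨⟩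
  powerSum (suc N) (suc i)                          ≡⟨ ∑-last N (_^ suc i) ⟩
  powerSum N (suc i) + N ^ suc i                    ∎)
  where
  open ≡-Reasoning
  F : ℕ → ℕ
  F l = (suc i C l) * powerSum N l

powerSum-suc : ∀ N {e} → 0 < e → powerSum (suc N) e ≡ ∑ N (λ j → suc j ^ e)
powerSum-suc N {suc e} _ = refl

G-as-powerSum : ∀ n → 0 < n / 2 → G (suc n) ≡ powerSum (suc n) (n / 2)
G-as-powerSum n 0<e = trans (sum-map-applyUpTo n (λ i → suc i ^ (n / 2)) id) (sym (powerSum-suc n 0<e))

-- Fermat's little theorem and power sums modulo a prime p = q + 1.
module PrimeModulus (q : ℕ) (p-prime : Prime (suc q)) where

  p : ℕ
  p = suc q

  0<q : 0 < q
  0<q = n≢0⇒n>0 (λ q≡0 → ¬prime[1] (subst (Prime ∘ suc) q≡0 p-prime))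

  p∤ : ∀ {j} → 0 < j → j < p → ¬ p ∣ j
  p∤ 0<j j<p = >⇒∤ {{>-nonZero 0<j}} j<p

  -- a ^ p ≡ a: expand (a + 1) ^ p; all inner binomial coefficients vanish mod p.
  fermat : ∀ a → a ^ p ≡ a mod p
  fermat zero    = mod-refl
  fermat (suc a) = begin
    suc a ^ p                                               ≡⟨ binomial p a ⟩
    1 + ∑ p (λ l → (p C suc l) * a ^ suc l)                 ≡⟨ cong (1 +_) (∑-last q (λ l → (p C suc l) * a ^ suc l)) ⟩
    1 + (∑ q (λ l → (p C suc l) * a ^ suc l) + (p C p) * a ^ p)
      ≈⟨ mod-+ (mod-refl {a = 1}) (mod-+ (∣⇒≡0 (∑-∣ q _ inner-terms)) (mod-reflexive outer-term)) ⟩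
    1 + a ^ p                                               ≈⟨ mod-+ (mod-refl {a = 1}) (fermat a) ⟩
    suc a                                                   ∎
    where
    open ≡-mod-Reasoning p
    inner-terms : ∀ l → l < q → p ∣ (p C suc l) * a ^ suc l
    inner-terms l l<q = ∣m⇒∣m*n (a ^ suc l) (prime∣C p-prime z<s (s<s l<q))
    outer-term : (p C p) * a ^ p ≡ a ^ p
    outer-term = trans (cong (_* a ^ p) (nCn≡1 p)) (*-identityˡ (a ^ p))

  fermat-periodic : ∀ a i s → 0 < i → a ^ (i + s * q) ≡ a ^ i mod p
  fermat-periodic a i       zero    _   = mod-reflexive (cong (a ^_) (+-identityʳ i))
  fermat-periodic a (suc i) (suc s) 0<i = begin
    a ^ (suc i + (q + s * q))       ≡⟨ cong (a ^_) (regroup i q (s * q)) ⟩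
    a ^ ((i + s * q) + p)           ≡⟨ ^-distribˡ-+-* a (i + s * q) p ⟩
    a ^ (i + s * q) * a ^ p         ≈⟨ mod-*ˡ (a ^ (i + s * q)) (fermat a) ⟩
    a ^ (i + s * q) * a             ≡⟨ *-comm (a ^ (i + s * q)) a ⟩
    a ^ (suc i + s * q)             ≈⟨ fermat-periodic a (suc i) s 0<i ⟩
    a ^ suc i                       ∎
    where
    open ≡-mod-Reasoning p
    regroup : ∀ i q t → suc i + (q + t) ≡ (i + t) + suc q
    regroup = solve-∀

  fermat-unit : ∀ {j} → 0 < j → j < p → j ^ q ≡ 1 mod p
  fermat-unit {j} 0<j j<p = mod-cancel p-prime (p∤ 0<j j<p)
    (mod-trans (fermat j) (mod-reflexive (sym (*-identityʳ j))))

  -- p ∣ powerSum p i for i < q, by strong induction on i: in the telescoping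
  -- identity for N = p every term but (i + 1) * powerSum p i is divisible by p.
  powerSum-below : ∀ i → i < q → p ∣ powerSum p i
  powerSum-below = <-rec _ step
    where
    step : ∀ i → (∀ {l} → l < i → l < q → p ∣ powerSum p l) → i < q → p ∣ powerSum p i
    step i earlier i<q with euclidsLemma (suc i) (powerSum p i) p-prime p∣last
      where
      F : ℕ → ℕ
      F l = (suc i C l) * powerSum p l
      p∣all : p ∣ ∑ i F + F i
      p∣all = subst (p ∣_) (trans (sym (telescoping p i)) (∑-last i F)) (m∣m*n (p ^ i))
      p∣earlier : p ∣ ∑ i F
      p∣earlier = ∑-∣ i F (λ l l<i → ∣n⇒∣m*n (suc i C l) (earlier l<i (<-trans l<i i<q)))
      C[i+1,i]≡i+1 : suc i C i ≡ suc i
      C[i+1,i]≡i+1 = trans (nCk≡nC[n∸k] (n≤1+n i)) (trans (cong (suc i C_) (m+n∸n≡m 1 i)) (nC1≡n (suc i)))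
      p∣last : p ∣ suc i * powerSum p i
      p∣last = subst (λ c → p ∣ c * powerSum p i) C[i+1,i]≡i+1 (∣m+n∣m⇒∣n p∣all p∣earlier)
    ... | inj₁ p∣i+1 = contradiction p∣i+1 (p∤ z<s (s<s i<q))
    ... | inj₂ p∣sum = p∣sum

  powerSum-periodic : ∀ i s → 0 < i → powerSum p (i + s * q) ≡ powerSum p i mod p
  powerSum-periodic i s 0<i = mod-∑ p (λ j _ → fermat-periodic j i s 0<i)

  -- For a positive multiple e of q, powerSum p e ≡ 1 + ⋯ + 1 = q, not divisible by p.
  powerSum-full-period : ∀ s → ¬ p ∣ powerSum p (q * suc s)
  powerSum-full-period s p∣sum = p∤ 0<q (n<1+n q) (mod-∣ sum≡q p∣sum)
    where
    open ≡-mod-Reasoning p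
    e = q * suc s
    unit-power : ∀ j → j < q → suc j ^ e ≡ 1 mod p
    unit-power j j<q = begin
      suc j ^ (q * suc s)  ≡⟨ ^-*-assoc (suc j) q (suc s) ⟨
      (suc j ^ q) ^ suc s  ≈⟨ mod-^ (fermat-unit z<s (s<s j<q)) (suc s) ⟩
      1 ^ suc s            ≡⟨ ^-zeroˡ (suc s) ⟩
      1                    ∎
    sum≡q : powerSum p e ≡ q mod p
    sum≡q = begin
      powerSum p e               ≡⟨ powerSum-suc q (<-≤-trans 0<q (m≤m*n q (suc s))) ⟩
      ∑ q (λ j → suc j ^ e)      ≈⟨ mod-∑ q unit-power ⟩
      ∑ q (λ _ → 1)              ≡⟨ ∑-const q 1 ⟩
      q * 1                      ≡⟨ *-identityʳ q ⟩
      q                          ∎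

-- Power sums modulo powers of an odd number m = 2h + 1, and the shape of m ^ k.
module OddModulus (h : ℕ) where

  q : ℕ
  q = 2 * h

  m : ℕ
  m = suc q

  -- If m ∣ c, then powerSum (m c) e ≡ m * powerSum c e (mod m c): write
  -- j = a c + b and expand (b + a c) ^ e to first order modulo c², a multiple
  -- of m c; with D = ∑_{b<c} e b ^ (e - 1) the first-order terms add up to
  -- (0 + 1 + ⋯ + 2h) * c * D = m c * h * D ≡ 0.
  powerSum-blocks : ∀ c e → m ∣ c → powerSum (m * c) e ≡ m * powerSum c e mod m * c
  powerSum-blocks c e m∣c = begin
    powerSum (m * c) e                                          ≡⟨ ∑-blocks m c (_^ e) ⟩
    ∑ m (λ a → ∑ c (λ b → (a * c + b) ^ e))                     ≈⟨ mod-∑ m (λ a _ → mod-∑ c (λ b _ → expansion a b)) ⟩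
    ∑ m (λ a → ∑ c (λ b → b ^ e + a * c * derivative e b))      ≡⟨ ∑-cong m (λ a _ → inner-sum a) ⟩
    ∑ m (λ a → powerSum c e + a * (c * D))                      ≡⟨ ∑-+ m (λ _ → powerSum c e) (λ a → a * (c * D)) ⟩
    ∑ m (λ _ → powerSum c e) + ∑ m (λ a → a * (c * D))          ≡⟨ cong₂ _+_ (∑-const m (powerSum c e)) (∑-*ʳ m (c * D) id) ⟩
    m * powerSum c e + ∑ m id * (c * D)                         ≡⟨ cong (λ s → m * powerSum c e + s * (c * D)) (∑-id-odd h) ⟩
    m * powerSum c e + m * h * (c * D)                          ≡⟨ cong (m * powerSum c e +_) (regroup m h c D) ⟩
    m * powerSum c e + m * c * (h * D)                          ≈⟨ mod-multiple (m * powerSum c e) (h * D) ⟩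
    m * powerSum c e                                            ∎
    where
    open ≡-mod-Reasoning (m * c)
    D : ℕ
    D = ∑ c (derivative e)
    expansion : ∀ a b → (a * c + b) ^ e ≡ b ^ e + a * c * derivative e b mod m * c
    expansion a b = begin
      (a * c + b) ^ e                        ≡⟨ cong (_^ e) (+-comm (a * c) b) ⟩
      (b + a * c) ^ e                        ≈⟨ mod-divisor (*-pres-∣ (∣n⇒∣m*n a m∣c) (n∣m*n a)) (first-order e b (a * c)) ⟩
      b ^ e + a * c * derivative e b         ∎
    inner-sum : ∀ a → ∑ c (λ b → b ^ e + a * c * derivative e b) ≡ powerSum c e + a * (c * D)
    inner-sum a = trans (∑-+ c (_^ e) (λ b → a * c * derivative e b))
      (cong (powerSum c e +_) (trans (∑-*ˡ c (a * c) (derivative e)) (*-assoc a c D)))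
    regroup : ∀ m h c D → m * h * (c * D) ≡ m * c * (h * D)
    regroup = solve-∀

  powerSum-lift : ∀ k e → powerSum (m ^ suc k) e ≡ m ^ k * powerSum m e mod m ^ suc k
  powerSum-lift zero    e = mod-reflexive
    (trans (cong (λ n → powerSum n e) (*-identityʳ m)) (sym (*-identityˡ (powerSum m e))))
  powerSum-lift (suc k) e = begin
    powerSum (m * m ^ suc k) e        ≈⟨ powerSum-blocks (m ^ suc k) e (m∣m*n (m ^ k)) ⟩
    m * powerSum (m ^ suc k) e        ≈⟨ mod-scale m (powerSum-lift k e) ⟩
    m * (m ^ k * powerSum m e)        ≡⟨ *-assoc m (m ^ k) (powerSum m e) ⟨
    m ^ suc k * powerSum m e          ∎
    where open ≡-mod-Reasoning (m ^ suc (suc k))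

  powerSum-lift-∣ : ∀ k e → (m ^ suc k ∣ powerSum (m ^ suc k) e ⇔ m ∣ powerSum m e)
  powerSum-lift-∣ k e = mk⇔
    (λ m^[k+1]∣ → *-cancelˡ-∣ (m ^ k) {{m^n≢0 m k}}
       (subst (_∣ m ^ k * powerSum m e) (*-comm m (m ^ k)) (mod-∣ (powerSum-lift k e) m^[k+1]∣)))
    (λ m∣ → mod-∣ (mod-sym (powerSum-lift k e))
       (subst (_∣ m ^ k * powerSum m e) (*-comm (m ^ k) m) (*-monoʳ-∣ (m ^ k) m∣)))

  -- Powers of m²: each is 1 + q * (2 s), and multiplying by m² once more
  -- keeps this form with a positive s.
  square-step : ∀ s → m * m * suc (q * (2 * s)) ≡ suc (q * (2 * suc (h + s + q * (2 * (suc h * s)))))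
  square-step s = identity h s
    where
    identity : ∀ h s → suc (2 * h) * suc (2 * h) * suc (2 * h * (2 * s))
                     ≡ suc (2 * h * (2 * suc (h + s + 2 * h * (2 * (suc h * s)))))
    identity = solve-∀

  square-powers : ∀ r → ∃[ s ] (m * m) ^ r ≡ suc (q * (2 * s))
  square-powers zero    = 0 , cong suc (sym (*-zeroʳ q))
  square-powers (suc r) with square-powers r
  ... | s , eq = suc (h + s + q * (2 * (suc h * s))) , trans (cong (m * m *_) eq) (square-step s)

  even-power-form : ∀ r → ∃[ s ] m ^ (2 * suc r) ≡ suc (q * (2 * suc s))
  even-power-form r with square-powers r
  ... | s , eq = h + s + q * (2 * (suc h * s)) , (begin
    m ^ (2 * suc r)             ≡⟨ ^-*-assoc m 2 (suc r) ⟨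
    (m * (m * 1)) ^ suc r       ≡⟨ cong (λ n → (m * n) ^ suc r) (*-identityʳ m) ⟩
    m * m * (m * m) ^ r         ≡⟨ cong (m * m *_) eq ⟩
    m * m * suc (q * (2 * s))   ≡⟨ square-step s ⟩
    suc (q * (2 * suc (h + s + q * (2 * (suc h * s))))) ∎)
    where open ≡-Reasoning

  odd-power-form : ∀ r → ∃[ s ] m ^ suc (2 * r) ≡ suc (q * suc (2 * (s * m)))
  odd-power-form r with square-powers r
  ... | s , eq = s , (begin
    m * m ^ (2 * r)             ≡⟨ cong (m *_) (^-*-assoc m 2 r) ⟨
    m * (m * (m * 1)) ^ r       ≡⟨ cong (λ n → m * (m * n) ^ r) (*-identityʳ m) ⟩
    m * (m * m) ^ r             ≡⟨ cong (m *_) eq ⟩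
    m * suc (q * (2 * s))       ≡⟨ identity h s ⟩
    suc (q * suc (2 * (s * m))) ∎)
    where
    open ≡-Reasoning
    identity : ∀ h s → suc (2 * h) * suc (2 * h * (2 * s)) ≡ suc (2 * h * suc (2 * (s * suc (2 * h))))
    identity = solve-∀

  G-criterion : ∀ k X → 0 < k → 0 < h * X → m ^ k ≡ suc (q * X) →
                (m ^ k ∣ G (m ^ k) ⇔ m ∣ powerSum m (h * X))
  G-criterion (suc k) X _ 0<hX m^k≡ =
    subst (λ g → m ^ suc k ∣ g ⇔ m ∣ powerSum m (h * X)) (sym G≡powerSum) (powerSum-lift-∣ k (h * X))
    where
    open ≡-Reasoning
    half : q * X / 2 ≡ h * X
    half = trans (cong (_/ 2) (identity h X)) (m*n/n≡m (h * X) 2)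
      where
      identity : ∀ h X → 2 * h * X ≡ h * X * 2
      identity = solve-∀
    G≡powerSum : G (m ^ suc k) ≡ powerSum (m ^ suc k) (h * X)
    G≡powerSum = begin
      G (m ^ suc k)                       ≡⟨ cong G m^k≡ ⟩
      G (suc (q * X))                     ≡⟨ G-as-powerSum (q * X) (subst (0 <_) (sym half) 0<hX) ⟩
      powerSum (suc (q * X)) (q * X / 2)  ≡⟨ cong₂ powerSum (sym m^k≡) half ⟩
      powerSum (m ^ suc k) (h * X)        ∎

even-or-odd : ∀ k → ∃[ r ] (k ≡ 2 * r ⊎ k ≡ suc (2 * r))
even-or-odd zero    = 0 , inj₁ refl
even-or-odd (suc k) with even-or-odd k
... | r , inj₁ k≡2r   = r , inj₂ (cong suc k≡2r)
... | r , inj₂ k≡2r+1 = suc r , inj₁ (trans (cong suc k≡2r+1) (sym (*-suc 2 r)))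

even-not-odd : ∀ r → ¬ Odd (2 * r)
even-not-odd r odd = odd (divides r (*-comm 2 r))

odd-suc-double : ∀ r → Odd (suc (2 * r))
odd-suc-double r 2∣2r+1 with ∣1⇒≡1 (∣m+n∣m⇒∣n (subst (2 ∣_) (+-comm 1 (2 * r)) 2∣2r+1) (divides r (*-comm 2 r)))
... | ()

module OddPrime (h : ℕ) (p-prime : Prime (suc (2 * h))) where
  open PrimeModulus (2 * h) p-prime
  open OddModulus h hiding (q)

  0<h : 0 < h
  0<h = n≢0⇒n>0 (λ h≡0 → <⇒≢ 0<q (sym (cong (2 *_) h≡0)))

  h<q : h < 2 * h
  h<q = m<m+n h (<-≤-trans 0<h (m≤m+n h 0))

  0<h* : ∀ X → .{{NonZero X}} → 0 < h * X
  0<h* X = <-≤-trans 0<h (m≤m*n h X)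

  -- For odd k = 2r + 1 the exponent of G (p ^ k) is h + (multiple of q), and
  -- p ∣ powerSum p h because h < q.
  odd-power∈𝔓 : ∀ r → 𝔓 (p ^ suc (2 * r))
  odd-power∈𝔓 r with odd-power-form r
  ... | s , p^k≡ = p^k-odd , m^n>0 p (suc (2 * r)) , Equivalence.from (G-criterion (suc (2 * r)) X z<s (0<h* X) p^k≡) p∣sum
    where
    X = suc (2 * (s * p))
    p^k-odd : Odd (p ^ suc (2 * r))
    p^k-odd = subst Odd (sym p^k≡) (subst (Odd ∘ suc) (sym (*-assoc 2 h X)) (odd-suc-double (h * X)))
    exponent : ∀ h t → h * suc (2 * t) ≡ h + t * (2 * h)
    exponent = solve-∀
    p∣sum : p ∣ powerSum p (h * X)
    p∣sum = subst (λ e → p ∣ powerSum p e) (sym (exponent h (s * p)))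
      (mod-∣ (mod-sym (powerSum-periodic h (s * p) 0<h))
             (powerSum-below h h<q))

  -- For even k = 2(r + 1) the exponent of G (p ^ k) is a positive multiple of q.
  even-power∉𝔓 : ∀ r → ¬ 𝔓 (p ^ (2 * suc r))
  even-power∉𝔓 r (_ , _ , p^k∣G) with even-power-form r
  ... | s , p^k≡ = powerSum-full-period s (subst (λ e → p ∣ powerSum p e) (exponent h s)
                     (Equivalence.to (G-criterion (2 * suc r) (2 * suc s) z<s (0<h* (2 * suc s)) p^k≡) p^k∣G))
    where
    exponent : ∀ h s → h * (2 * suc s) ≡ 2 * h * suc s
    exponent = solve-∀

mainTheorem3 : (p k : ℕ) → Prime p → Odd p → 1 ≤ k → (𝔓 (p ^ k) ⇔ Odd k)
mainTheorem3 p k p-prime p-odd 1≤k with even-or-odd p | even-or-odd k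
... | h , inj₁ refl | _                 = contradiction p-odd (even-not-odd h)
... | h , inj₂ refl | r , inj₂ refl     =
  mk⇔ (λ _ → odd-suc-double r) (λ _ → OddPrime.odd-power∈𝔓 h p-prime r)
... | h , inj₂ refl | suc r , inj₁ refl =
  mk⇔ (λ k∈𝔓 → contradiction k∈𝔓 (OddPrime.even-power∉𝔓 h p-prime r)) (λ k-odd → contradiction k-odd (even-not-odd (suc r)))
mainTheorem3 _ _ _ _ () | h , inj₂ refl | zero , inj₁ refl
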